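{- Let $H$ be a ribbon hypermap. If there exist four common line segments of $H$ that alternate at some hypervertex of $H$, then $\varepsilon(H)>0$.
   Context: A ribbon hypermap $H$ is a (possibly non-orientable) surface with boundary, written as the union of two sets of discs, the hypervertices $V(H)$ and the hyperedges $E(H)$, such that hypervertices and hyperedges meet in disjoint line segments (common line segments), each lying on the boundary of exactly one hypervertex and exactly one hyperedge. Hyperfaces are the boundary components of the surface. $v(H),e(H),f(H),k(H)$ are the numbers of hypervertices, hyperedges, hyperfaces and connected components; $d(e)$ is the number of common line segments on hyperedge $e$ and $d(H)=\sum_e d(e)$. The Euler genus is $\varepsilon(H)=2k(H)+d(H)-v(H)-e(H)-f(H)$. The ribbon graph $R(H)$: replace each hyperedge $e$ by a new vertex disc $v_e$ (central vertex of $e$) and $d(e)$ ordinary edges $e_1,\dots,e_{d(e)}$, the $i$-th joining $v_e$ to the hypervertex at the $i$-th common line segment of $e$, attached around $v_e$ in the cyclic order of the common line segments along the boundary of $e$ (the natural ribbon graph associated with $H$, with $\varepsilon(R(H))=\varepsilon(H)$). Four common line segments $cl_1,cl_2,cl_3,cl_4$ of hyperedges $e,f,g,h$ respectively (possibly $e=g$ and/or $f=h$) alternate at a hypervertex $v$ if they lie on $v$ in the cyclic order $(cl_1\cdots cl_2\cdots cl_3\cdots cl_4\cdots)$ around the boundary of $v$, and $v_e,v_g$ lie in one connected component of $R(H)\setminus v$ (the ribbon graph with $v$ and its incident edges removed) while $v_f,v_h$ lie in a different connected component of $R(H)\setminus v$. -}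

module Defs where

open import Data.Nat using (ℕ; zero; suc; _+_; _*_; _<_; _≤_)
open import Data.Integer as ℤ using (ℤ; +_)
open import Data.Fin using (Fin)
open import Data.Bool using (Bool; not)
open import Data.Product using (_×_; _,_; ∃; ∃-syntax; Σ-syntax)
open import Relation.Binary.PropositionalEquality using (_≡_; _≢_)
open import Relation.Binary.Construct.Closure.ReflexiveTransitive using (Star)
open import Relation.Nullary using (¬_)

-- The common line segments are numbered 0 .. d-1 (so d = d(H)).
-- Each segment s has two endpoints (s , false) and (s , true);
-- an endpoint is a point of the boundary of the surface where the
-- boundary of a hypervertex and the boundary of a hyperedge meet.
--
-- The boundary circle of a hypervertex disc alternates between common
-- line segments and "free" boundary arcs; a free arc of a hypervertex
-- joins two endpoints.  α pairs up the two endpoints of each free arc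
-- of a hypervertex (a fixed-point-free involution on endpoints).
-- Likewise β pairs the endpoints of the free arcs of hyperedges.
-- τ swaps the two endpoints of a segment.  This data determines the
-- surface up to homeomorphism (gluing each segment to its hypervertex
-- and hyperedge according to the endpoint labels), and every such data
-- arises.  Discs carrying no common line segment at all are recorded
-- by the two numbers isoV / isoE.
-- ============================================================

Pt : ℕ → Set
Pt d = Fin d × Bool

τ : ∀ {d} → Pt d → Pt d
τ (s , b) = (s , not b)

record RibbonHypermap : Set where
  field
    d      : ℕ
    α      : Pt d → Pt d
    β      : Pt d → Pt d
    α-inv  : ∀ p → α (α p) ≡ p
    α-fpf  : ∀ p → α p ≢ p
    β-inv  : ∀ p → β (β p) ≡ p
    β-fpf  : ∀ p → β p ≢ p
    isoV   : ℕ
    isoE   : ℕ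

open RibbonHypermap public

data VStep (H : RibbonHypermap) : Pt (d H) → Pt (d H) → Set where
  vτ : ∀ p → VStep H p (τ p)
  vα : ∀ p → VStep H p (α H p)

data EStep (H : RibbonHypermap) : Pt (d H) → Pt (d H) → Set where
  eτ : ∀ p → EStep H p (τ p)
  eβ : ∀ p → EStep H p (β H p)

-- along the boundary of the surface (hyperfaces)
data FStep (H : RibbonHypermap) : Pt (d H) → Pt (d H) → Set where
  fα : ∀ p → FStep H p (α H p)
  fβ : ∀ p → FStep H p (β H p)

-- inside the surface (connected components)
data KStep (H : RibbonHypermap) : Pt (d H) → Pt (d H) → Set where
  kτ : ∀ p → KStep H p (τ p)
  kα : ∀ p → KStep H p (α H p)
  kβ : ∀ p → KStep H p (β H p)

-- "c is the number of equivalence classes of the reflexive-transitive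
-- closure of R" (R is symmetric here, all moves being involutions).
record ClassCount {A : Set} (R : A → A → Set) (c : ℕ) : Set where
  field
    cls      : A → Fin c
    cls-surj : ∀ i → ∃[ p ] cls p ≡ i
    cls-sound    : ∀ p q → cls p ≡ cls q → Star R p q
    cls-complete : ∀ p q → Star R p q → cls p ≡ cls q

-- Euler genus  ε = 2k + d - v - e - f, where the numbers of
-- hypervertices / hyperedges / hyperfaces / components with common
-- line segments are nv, ne, nf, nk, and each isolated disc contributes
-- one hypervertex (or hyperedge), one hyperface and one component.
eulerGenus : (H : RibbonHypermap) (nv ne nf nk : ℕ) → ℤ
eulerGenus H nv ne nf nk =
  ((+ (2 * (nk + isoV H + isoE H))) ℤ.+ (+ d H))
  ℤ.- (+ (nv + isoV H)) ℤ.- (+ (ne + isoE H)) ℤ.- (+ (nf + isoV H + isoE H))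

SameV : (H : RibbonHypermap) → Pt (d H) → Pt (d H) → Set
SameV H = Star (VStep H)

-- moves in R(H) \ v, where v is the hypervertex containing the point p0:
-- moving along a hyperedge (τ, β) is always allowed; moving along a
-- hypervertex (α) only for hypervertices other than v.
-- Two endpoints are connected by these moves iff the central vertices
-- of their hyperedges lie in the same component of R(H) \ v.
data AvoidStep (H : RibbonHypermap) (p0 : Pt (d H)) : Pt (d H) → Pt (d H) → Set where
  aτ : ∀ p → AvoidStep H p0 p (τ p)
  aβ : ∀ p → AvoidStep H p0 p (β H p)
  aα : ∀ p → ¬ SameV H p p0 → AvoidStep H p0 p (α H p)

iter : ∀ {A : Set} → (A → A) → ℕ → A → A
iter f zero x = x
iter f (suc n) x = f (iter f n x)

-- walking around the boundary of a hypervertex, segment by segment: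
-- from endpoint p go to the other end τ p of its segment, then along
-- the free arc to the next segment.  The ρ-orbit of p visits each
-- segment of the hypervertex exactly once per period.
ρ : (H : RibbonHypermap) → Pt (d H) → Pt (d H)
ρ H p = α H (τ p)

-- Four common line segments alternate at some hypervertex:
-- starting at an endpoint p of cl₁ and walking around the hypervertex v
-- of p we meet cl₂, cl₃, cl₄ (at steps i < j < k, before returning to
-- the start, so the four segments are distinct and in this cyclic
-- order); the central vertices of the hyperedges of cl₁ and cl₃ are in
-- one component of R(H) \ v, those of cl₂ and cl₄ are in one component,
-- and these components are different.
HasAlternating : RibbonHypermap → Set
HasAlternating H =
  Σ[ p ∈ Pt (d H) ] Σ[ i ∈ ℕ ] Σ[ j ∈ ℕ ] Σ[ k ∈ ℕ ]
    ( 0 < i × i < j × j < k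
    × (∀ t → 1 ≤ t → t ≤ k → iter (ρ H) t p ≢ p)
    × Star (AvoidStep H p) p (iter (ρ H) j p)
    × Star (AvoidStep H p) (iter (ρ H) i p) (iter (ρ H) k p)
    × ¬ Star (AvoidStep H p) p (iter (ρ H) i p) )

-- The ends of the d common line segments form a set of 2d points carrying three
-- fixed-point-free involutions τ, α, β.  Hypervertices, hyperedges and hyperfaces are the
-- orbits of ⟨τ,α⟩, ⟨τ,β⟩ and ⟨α,β⟩, and each of the 3d edges {x, c x} of the cubic graph so
-- obtained lies on exactly two of them; this makes a primal graph on v + e + f nodes in which
-- the three edges at a point form a triangle.  Take a spanning forest T of the cubic graph
-- (2d − k edges).  Peeling T from its leaves, the triangles show that the cotree edges alone
-- connect each of the k components of the primal graph, so there are at least v + e + f − k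
-- of them: v + e + f ≤ d + 2k, i.e. ε ≥ 0.
--
-- Now let cl₁, …, cl₄ alternate at v and let g be the τ-edge of cl₃.  Going around v from the
-- far end of cl₃ to cl₄, through the component of R(H) ∖ v containing cl₂ and cl₄ back to cl₂,
-- and around v again to cl₃ gives a walk W avoiding g; a forest T that follows W leaves g out.
-- The other component joins cl₁ to cl₃ by edges off W, which connects the two ends of g
-- without using g.  Hence the cotree edges other than g still connect every component, and
-- v + e + f + 1 ≤ d + 2k, i.e. ε > 0.

module Submission where

open import Defs

module Finite where

  open import Data.Nat using (ℕ; zero; suc; _+_; _*_; _≤_; _<_; _≤′_; ≤′-refl; ≤′-step; z≤n; s≤s; _⊔_)
  open import Data.Nat.Properties using (≤-refl; ≤-trans; <-irrefl; ≤-<-trans; n<1+n; m≤m⊔n; m≤n⊔m; ≰⇒>; _≤?_; ≤-antisym; ≤⇒≤′)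
  open import Data.Fin using (Fin)
  import Data.Fin.Properties as Fin
  open import Data.Sum using (_⊎_; inj₁; inj₂)
  open import Data.Sum.Function.Propositional using (_⊎-↔_)
  open import Data.Product using (∃; ∃-syntax; _×_; _,_)
  open import Data.Product.Function.NonDependent.Propositional using (_×-↔_)
  open import Function using (_∘_; _↔_; Injective; Inverse)
  open import Function.Properties.Inverse using (↔-trans)
  open import Relation.Binary.PropositionalEquality using (_≡_; refl; sym; trans; cong; subst)
  open import Relation.Binary.Construct.Closure.ReflexiveTransitive using (Star; ε; _◅_)
  open import Relation.Nullary using (¬_; Dec; yes; no; contradiction)
  open import Relation.Nullary.Decidable using (_×-dec_; _⊎-dec_)
  open import Relation.Unary using (Decidable)

  open Inverse using (to; from; strictlyInverseˡ; strictlyInverseʳ)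

  Exhaustible : Set → Set₁
  Exhaustible A = ∀ {Q : A → Set} → Decidable Q → Dec (∃ Q)

  ↔Fin⇒exhaustible : ∀ {A : Set} {n} → Fin n ↔ A → Exhaustible A
  ↔Fin⇒exhaustible A≅ {Q} Q? with Fin.any? (Q? ∘ to A≅)
  ... | yes (i , q) = yes (to A≅ i , q)
  ... | no ∄q = no λ (a , q) → ∄q (from A≅ a , subst Q (sym (strictlyInverseˡ A≅ a)) q)

  ↔Fin⇒bounded : ∀ {A : Set} {n} → Fin n ↔ A → (f : A → ℕ) → ∃[ B ] (∀ a → f a ≤ B)
  ↔Fin⇒bounded {n = n} A≅ f = B , λ a → subst (λ a → f a ≤ B) (strictlyInverseˡ A≅ a) (bound n (f ∘ to A≅) (from A≅ a))
    where
    max : ∀ n → (Fin n → ℕ) → ℕ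
    max zero g = 0
    max (suc n) g = g Fin.zero ⊔ max n (g ∘ Fin.suc)
    bound : ∀ n (g : Fin n → ℕ) i → g i ≤ max n g
    bound (suc n) g Fin.zero = m≤m⊔n _ _
    bound (suc n) g (Fin.suc i) = ≤-trans (bound n (g ∘ Fin.suc) i) (m≤n⊔m _ _)
    B : ℕ
    B = max n (f ∘ to A≅)

  _×-Fin↔_ : ∀ {A B : Set} {m n} → Fin m ↔ A → Fin n ↔ B → Fin (m * n) ↔ (A × B)
  A≅ ×-Fin↔ B≅ = ↔-trans Fin.*↔× (A≅ ×-↔ B≅)

  _⊎-Fin↔_ : ∀ {A B : Set} {m n} → Fin m ↔ A → Fin n ↔ B → Fin (m + n) ↔ (A ⊎ B)
  A≅ ⊎-Fin↔ B≅ = ↔-trans Fin.+↔⊎ (A≅ ⊎-↔ B≅)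

  injective⇒size-≤ : ∀ {A B : Set} {m n} → Fin m ↔ A → Fin n ↔ B → (f : A → B) → Injective _≡_ _≡_ f → m ≤ n
  injective⇒size-≤ A≅ B≅ f f-inj = Fin.injective⇒≤ λ {i} {j} eq →
    trans (sym (strictlyInverseʳ A≅ i))
      (trans (cong (from A≅) (f-inj (trans (sym (strictlyInverseˡ B≅ _)) (trans (cong (to B≅) eq) (strictlyInverseˡ B≅ _)))))
        (strictlyInverseʳ A≅ j))

  -- least n is the least m ≤ n with P m, and n itself if there is none.  It is opaque because
  -- unfolding the search during conversion checking is very expensive.
  module LeastSearch {P : ℕ → Set} (P? : Decidable P) where

    opaque

      least : ℕ → ℕ
      least zero = zero
      least (suc n) with P? (least n)
      ... | yes _ = least n
      ... | no _ = suc n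

      least-satisfies : ∀ {m n} → m ≤ n → P m → P (least n)
      least-satisfies {n = zero} z≤n pm = pm
      least-satisfies {m} {suc n} m≤1+n pm with P? (least n) | m ≤? n
      ... | yes pl | _ = pl
      ... | no ¬pl | yes m≤n = contradiction (least-satisfies m≤n pm) ¬pl
      ... | no _ | no m≰n = subst P (≤-antisym m≤1+n (≰⇒> m≰n)) pm

      least-minimal : ∀ {m} n → P m → least n ≤ m
      least-minimal zero pm = z≤n
      least-minimal {m} (suc n) pm with P? (least n) | m ≤? n
      ... | yes _ | _ = least-minimal n pm
      ... | no ¬pl | yes m≤n = contradiction (least-satisfies m≤n pm) ¬pl
      ... | no _ | no m≰n = ≰⇒> m≰n

  length : ∀ {A : Set} {R : A → A → Set} {x y} → Star R x y → ℕ
  length ε = 0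
  length (_ ◅ s) = suc (length s)

  -- Breadth-first forest: dist x is the least number of labelled steps from x to a root (searched
  -- up to bound x), and a non-root x steps along the label parent x to a point of smaller dist;
  -- default is the junk parent of roots.
  module SpanningForest {X L : Set} (any-L : Exhaustible L)
    (Root : X → Set) (root? : Decidable Root)
    (Adj : X → L → Set) (adj? : ∀ x l → Dec (Adj x l))
    (next : X → L → X) (bound : X → ℕ) (default : L) where

    Reach : ℕ → X → Set
    Reach zero x = Root x
    Reach (suc n) x = Reach n x ⊎ ∃[ l ] Adj x l × Reach n (next x l)

    reach? : ∀ n → Decidable (Reach n)
    reach? zero x = root? x
    reach? (suc n) x = reach? n x ⊎-dec any-L (λ l → adj? x l ×-dec reach? n (next x l))

    reach-mono : ∀ {m n x} → m ≤ n → Reach m x → Reach n x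
    reach-mono {x = x} m≤n = go (≤⇒≤′ m≤n)
      where
      go : ∀ {m n} → m ≤′ n → Reach m x → Reach n x
      go ≤′-refl r = r
      go (≤′-step m≤′n) r = inj₁ (go m≤′n r)

    dist : X → ℕ
    dist x = LeastSearch.least (λ n → reach? n x) (bound x)

    reach-dist : ∀ {x} → Reach (bound x) x → Reach (dist x) x
    reach-dist {x} = LeastSearch.least-satisfies (λ n → reach? n x) {bound x} ≤-refl

    dist-minimal : ∀ {n x} → Reach n x → dist x ≤ n
    dist-minimal {x = x} = LeastSearch.least-minimal (λ n → reach? n x) (bound x)

    parentAt : ℕ → X → L
    parentAt zero x = default
    parentAt (suc n) x with any-L (λ l → adj? x l ×-dec reach? n (next x l))
    ... | yes (l , _) = l
    ... | no _ = default

    parentAt-step : ∀ n x → ∃[ l ] Adj x l × Reach n (next x l) →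
                    Adj x (parentAt (suc n) x) × Reach n (next x (parentAt (suc n) x))
    parentAt-step n x w with any-L (λ l → adj? x l ×-dec reach? n (next x l))
    ... | yes (_ , step) = step
    ... | no ∄step = contradiction w ∄step

    parent : X → L
    parent x = parentAt (dist x) x

    parent-step : ∀ x → Reach (bound x) x → ¬ Root x → Adj x (parent x) × dist (next x (parent x)) < dist x
    parent-step x r ¬root = go (dist x) refl (reach-dist r)
      where
      go : ∀ n → n ≡ dist x → Reach n x → Adj x (parentAt n x) × dist (next x (parentAt n x)) < dist x
      go zero _ root = contradiction root ¬root
      go (suc n) n≡d (inj₁ r′) = contradiction (≤-<-trans (dist-minimal r′) (subst (n <_) n≡d (n<1+n n))) (<-irrefl refl)
      go (suc n) n≡d (inj₂ w) =
        let adj , r′ = parentAt-step n x w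
        in adj , subst (dist (next x (parentAt (suc n) x)) <_) n≡d (s≤s (dist-minimal r′))

module Hypermap where

  open Finite

  open import Data.Nat using (ℕ; zero; suc; _+_; _*_; _∸_; _≤_; _<_; _≤′_; ≤′-refl; ≤′-step; z≤n)
  open import Data.Nat.Properties
    using (≤-refl; ≤-trans; ≤-pred; <-irrefl; <-trans; <⇒≤; <-≤-trans; <-cmp; ∸-monoʳ-<; n≮0; +-comm; +-suc; +-identityʳ;
           m∸n+n≡m; m+[n∸m]≡n; m<n⇒0<n∸m; m∸n≤m; n≤1+n; m≤m+n; ≤⇒≤′; ≤′⇒≤; *-cancelʳ-≤; +-cancelʳ-≤)
  open import Data.Fin using (Fin)
  open import Data.Fin.Patterns using (0F; 1F; 2F)
  import Data.Fin.Properties as Fin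
  open import Data.Bool using (Bool; true; false; not)
  open import Data.Bool.Properties using (not-involutive; ¬-not)
  import Data.Bool.Properties as Bool
  open import Data.Sum using (_⊎_; inj₁; inj₂; swap; [_,_])
  open import Data.Sum.Properties using (inj₁-injective; inj₂-injective)
  import Data.Sum.Properties as Sum
  open import Data.Product using (∃-syntax; _×_; _,_; proj₁; proj₂)
  open import Data.Product.Properties using (,-injectiveˡ; ,-injectiveʳ)
  import Data.Product.Properties as Product
  open import Data.Unit using (⊤; tt)
  open import Data.Empty using (⊥)
  open import Function using (_∘_; id; _↔_; Inverse; mk↔ₛ′)
  open import Function.Properties.Inverse using (↔-refl)
  open import Relation.Binary using (DecidableEquality; tri<; tri≈; tri>)
  open import Relation.Binary.PropositionalEquality using (_≡_; _≢_; refl; sym; trans; cong; cong₂; subst; subst₂; module ≡-Reasoning)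
  open import Relation.Binary.Construct.Closure.ReflexiveTransitive using (Star; ε; _◅_; _◅◅_; revApp; reverse)
  import Relation.Binary.Construct.Closure.ReflexiveTransitive as Star
  open import Relation.Nullary using (¬_; Dec; yes; no; contradiction)
  open import Relation.Nullary.Decidable using (_×-dec_; _⊎-dec_; ¬?; map′)
  open import Relation.Unary using (Decidable)
  import Data.Nat.Tactic.RingSolver as ℕ-Solver

  open Inverse using (to; from; strictlyInverseˡ)

  data Colour : Set where
    cτ cα cβ : Colour

  colour↔ : Fin 3 ↔ Colour
  colour↔ = mk↔ₛ′ to′ from′ (λ { cτ → refl ; cα → refl ; cβ → refl }) (λ { 0F → refl ; 1F → refl ; 2F → refl })
    where
    to′ : Fin 3 → Colour
    to′ 0F = cτ
    to′ 1F = cα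
    to′ 2F = cβ
    from′ : Colour → Fin 3
    from′ cτ = 0F
    from′ cα = 1F
    from′ cβ = 2F

  _≟ᶜ_ : DecidableEquality Colour
  c ≟ᶜ c′ = map′ (λ eq → trans (sym (strictlyInverseˡ colour↔ c)) (trans (cong (to colour↔) eq) (strictlyInverseˡ colour↔ c′)))
                 (cong (from colour↔))
                 (from colour↔ c Fin.≟ from colour↔ c′)

  τ-involutive : ∀ {n} (x : Pt n) → τ (τ x) ≡ x
  τ-involutive (s , b) = cong (s ,_) (not-involutive b)

  τ-fixedPointFree : ∀ {n} (x : Pt n) → τ x ≢ x
  τ-fixedPointFree (s , true) ()
  τ-fixedPointFree (s , false) ()

  module Gem (H : RibbonHypermap) where

    Point : Set
    Point = Pt (d H)

    _≟ₚ_ : DecidableEquality Point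
    _≟ₚ_ = Product.≡-dec Fin._≟_ Bool._≟_

    point↔ : Fin (d H * 2) ↔ Point
    point↔ = ↔-refl ×-Fin↔ Fin.2↔Bool

    move : Colour → Point → Point
    move cτ = τ
    move cα = α H
    move cβ = β H

    move-involutive : ∀ c x → move c (move c x) ≡ x
    move-involutive cτ = τ-involutive
    move-involutive cα = α-inv H
    move-involutive cβ = β-inv H

    move-fixedPointFree : ∀ c x → move c x ≢ x
    move-fixedPointFree cτ = τ-fixedPointFree
    move-fixedPointFree cα = α-fpf H
    move-fixedPointFree cβ = β-fpf H

    move-injective : ∀ c {x y} → move c x ≡ move c y → x ≡ y
    move-injective c {x} {y} eq = trans (sym (move-involutive c x)) (trans (cong (move c) eq) (move-involutive c y))

    HalfEdge : Set
    HalfEdge = Point × Colour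

    halfEdge↔ : Fin (d H * 2 * 3) ↔ HalfEdge
    halfEdge↔ = point↔ ×-Fin↔ colour↔

    infix 4 _≈_
    _≈_ : HalfEdge → HalfEdge → Set
    (x , c) ≈ (y , c′) = c ≡ c′ × (x ≡ y ⊎ x ≡ move c y)

    _≈?_ : ∀ h h′ → Dec (h ≈ h′)
    (x , c) ≈? (y , c′) = (c ≟ᶜ c′) ×-dec ((x ≟ₚ y) ⊎-dec (x ≟ₚ move c y))

    ≈-refl : ∀ {h} → h ≈ h
    ≈-refl = refl , inj₁ refl

    ≈-sym : ∀ {h h′} → h ≈ h′ → h′ ≈ h
    ≈-sym (refl , inj₁ refl) = refl , inj₁ refl
    ≈-sym {_ , c} {y , _} (refl , inj₂ refl) = refl , inj₂ (sym (move-involutive c y))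

    ≈-trans : ∀ {h h′ h″} → h ≈ h′ → h′ ≈ h″ → h ≈ h″
    ≈-trans (refl , inj₁ refl) q = q
    ≈-trans (refl , inj₂ refl) (refl , inj₁ refl) = refl , inj₂ refl
    ≈-trans {_ , c} {_ , _} {z , _} (refl , inj₂ refl) (refl , inj₂ refl) = refl , inj₁ (move-involutive c z)

    partner : HalfEdge → HalfEdge
    partner (x , c) = move c x , c

    partner-≈ : ∀ h → partner h ≈ h
    partner-≈ (x , c) = refl , inj₂ refl

    partner-≢ : ∀ h → partner h ≢ h
    partner-≢ (x , c) eq = move-fixedPointFree c x (cong proj₁ eq)

    ρ-injective : ∀ {x y} → ρ H x ≡ ρ H y → x ≡ y
    ρ-injective = move-injective cτ ∘ move-injective cα

    iter-ρ-injective : ∀ n {x y} → iter (ρ H) n x ≡ iter (ρ H) n y → x ≡ y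
    iter-ρ-injective zero eq = eq
    iter-ρ-injective (suc n) eq = iter-ρ-injective n (ρ-injective eq)

    iter-+ : ∀ m n x → iter (ρ H) (m + n) x ≡ iter (ρ H) m (iter (ρ H) n x)
    iter-+ zero n x = refl
    iter-+ (suc m) n x = cong (ρ H) (iter-+ m n x)

    -- ρˢ y and τ y lie at even and odd distance from y along the alternating τα-cycle.
    iter-ρ≢τ : ∀ s y → iter (ρ H) s y ≢ τ y
    iter-ρ≢τ zero y eq = τ-fixedPointFree y (sym eq)
    iter-ρ≢τ (suc zero) y eq = α-fpf H (τ y) eq
    iter-ρ≢τ (suc (suc s)) y eq = iter-ρ≢τ s (ρ H y) (begin
        iter (ρ H) s (ρ H y)    ≡⟨ iter-+ s 1 y ⟨
        iter (ρ H) (s + 1) y    ≡⟨ cong (λ n → iter (ρ H) n y) (+-comm s 1) ⟩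
        iter (ρ H) (suc s) y    ≡⟨ ρ-injective (trans eq (sym (trans (cong (α H) (τ-involutive (ρ H y))) (α-inv H (τ y))))) ⟩
        τ (ρ H y)               ∎)
      where open ≡-Reasoning

    record Step (x y : Point) : Set where
      constructor step
      field
        colour : Colour
        lands  : move colour x ≡ y

    Walk : Point → Point → Set
    Walk = Star Step

    edgeOf : ∀ {x y} → Step x y → HalfEdge
    edgeOf {x} s = x , Step.colour s

    step-sym : ∀ {x y} → Step x y → Step y x
    step-sym {x} (step c refl) = step c (move-involutive c x)

    edgeOf-step-sym : ∀ {x y} (s : Step x y) → edgeOf (step-sym s) ≈ edgeOf s
    edgeOf-step-sym (step c refl) = refl , inj₂ refl

    infix 4 _∈ʷ_
    _∈ʷ_ : ∀ {x y} → HalfEdge → Walk x y → Set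
    h ∈ʷ ε = ⊥
    h ∈ʷ (s ◅ w) = h ≈ edgeOf s ⊎ h ∈ʷ w

    _∈ʷ?_ : ∀ {x y} h (w : Walk x y) → Dec (h ∈ʷ w)
    h ∈ʷ? ε = no λ ()
    h ∈ʷ? (s ◅ w) = (h ≈? edgeOf s) ⊎-dec (h ∈ʷ? w)

    ∈ʷ-resp-≈ : ∀ {x y h h′} (w : Walk x y) → h ≈ h′ → h′ ∈ʷ w → h ∈ʷ w
    ∈ʷ-resp-≈ (s ◅ w) e (inj₁ q) = inj₁ (≈-trans e q)
    ∈ʷ-resp-≈ (s ◅ w) e (inj₂ q) = inj₂ (∈ʷ-resp-≈ w e q)

    ∈ʷ-◅◅ : ∀ {x y z h} (w : Walk x y) (w′ : Walk y z) → h ∈ʷ w ◅◅ w′ → h ∈ʷ w ⊎ h ∈ʷ w′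
    ∈ʷ-◅◅ ε w′ q = inj₂ q
    ∈ʷ-◅◅ (s ◅ w) w′ (inj₁ q) = inj₁ (inj₁ q)
    ∈ʷ-◅◅ (s ◅ w) w′ (inj₂ q) with ∈ʷ-◅◅ w w′ q
    ... | inj₁ q′ = inj₁ (inj₂ q′)
    ... | inj₂ q′ = inj₂ q′

    ∈ʷ-revApp : ∀ {x y z h} (w : Walk y x) (acc : Walk y z) → h ∈ʷ revApp step-sym w acc → h ∈ʷ w ⊎ h ∈ʷ acc
    ∈ʷ-revApp ε acc q = inj₂ q
    ∈ʷ-revApp (s ◅ w) acc q with ∈ʷ-revApp w (step-sym s ◅ acc) q
    ... | inj₁ q′ = inj₁ (inj₂ q′)
    ... | inj₂ (inj₁ q′) = inj₁ (inj₁ (≈-trans q′ (edgeOf-step-sym s)))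
    ... | inj₂ (inj₂ q′) = inj₂ q′

    ∈ʷ-reverse : ∀ {x y h} (w : Walk x y) → h ∈ʷ reverse step-sym w → h ∈ʷ w
    ∈ʷ-reverse w = [ id , (λ ()) ] ∘ ∈ʷ-revApp w ε

    module Forest
      (Root : Point → Set) (root? : Decidable Root) (up : Point → Colour)
      (rank : Point → ℕ) (rank-up : ∀ x → ¬ Root x → rank (move (up x) x) < rank x) where

      parent : Point → Point
      parent x = move (up x) x

      InTree : HalfEdge → Set
      InTree h = ∃[ y ] ¬ Root y × h ≈ (y , up y)

      InTree? : Decidable InTree
      InTree? h = ↔Fin⇒exhaustible point↔ (λ y → ¬? (root? y) ×-dec (h ≈? (y , up y)))

      tree-edge-injective : ∀ {x y} → ¬ Root x → ¬ Root y → (x , up x) ≈ (y , up y) → x ≡ y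
      tree-edge-injective _ _ (_ , inj₁ x≡y) = x≡y
      tree-edge-injective {x} {y} ¬rx ¬ry (ux≡uy , inj₂ x≡) = contradiction (<-trans rank-y<x rank-x<y) (<-irrefl refl)
        where
        y-parent : parent y ≡ x
        y-parent = trans (cong (λ c → move c y) (sym ux≡uy)) (sym x≡)
        x-parent : parent x ≡ y
        x-parent = trans (cong (move (up x)) x≡) (move-involutive (up x) y)
        rank-y<x : rank y < rank x
        rank-y<x = subst (λ z → rank z < rank x) x-parent (rank-up x ¬rx)
        rank-x<y : rank x < rank y
        rank-x<y = subst (λ z → rank z < rank y) y-parent (rank-up y ¬ry)

      -- Peeling the forest from its leaves: the tree edge above x is effective once the other
      -- two edges at x are, and those are cotree edges or tree edges above children of x.
      module Peel
        (Eff : HalfEdge → Set) (Eff-resp-≈ : ∀ {h h′} → h ≈ h′ → Eff h → Eff h′)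
        (Eff-third : ∀ x c → (∀ c′ → c′ ≢ c → Eff (x , c′)) → Eff (x , c))
        (Good : Point → Set) (Good-up : ∀ x → ¬ Root x → Good (parent x) → Good x)
        (cotree-eff : ∀ x c → Good x → ¬ InTree (x , c) → Eff (x , c)) where

        tree-eff : ∀ x → Good x → ¬ Root x → Eff (x , up x)
        tree-eff x = go (B ∸ rank x) x ≤-refl
          where
          B : ℕ
          B = proj₁ (↔Fin⇒bounded point↔ rank)
          go : ∀ n x → B ∸ rank x ≤ n → Good x → ¬ Root x → Eff (x , up x)
          go n x hx gx ¬rx = Eff-third x (up x) other-edge
            where
            other-edge : ∀ c → c ≢ up x → Eff (x , c)
            other-edge c c≢ with InTree? (x , c)
            ... | no ∉T = cotree-eff x c gx ∉T
            ... | yes (z , ¬rz , c≡ , inj₁ refl) = contradiction c≡ c≢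
            ... | yes (z , ¬rz , refl , inj₂ refl) = Eff-resp-≈ (≈-sym (partner-≈ (z , up z))) (child n hx)
              where
              deeper : B ∸ rank z < B ∸ rank x
              deeper = ∸-monoʳ-< (rank-up z ¬rz) (proj₂ (↔Fin⇒bounded point↔ rank) z)
              child : ∀ n → B ∸ rank x ≤ n → Eff (z , up z)
              child zero h = contradiction (<-≤-trans deeper h) n≮0
              child (suc n) h = go n z (≤-pred (<-≤-trans deeper h)) (Good-up z ¬rz gx) ¬rz

  module Primal (H : RibbonHypermap) {nv ne nf nk : ℕ}
    (cV : ClassCount (VStep H) nv) (cE : ClassCount (EStep H) ne)
    (cF : ClassCount (FStep H) nf) (cK : ClassCount (KStep H) nk) where

    open Gem H
    open ClassCount

    V : Point → Fin nv
    V = cls cV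
    E : Point → Fin ne
    E = cls cE
    F : Point → Fin nf
    F = cls cF
    K : Point → Fin nk
    K = cls cK

    V-τ : ∀ x → V (τ x) ≡ V x
    V-τ x = sym (cls-complete cV x (τ x) (vτ x ◅ ε))
    V-α : ∀ x → V (α H x) ≡ V x
    V-α x = sym (cls-complete cV x (α H x) (vα x ◅ ε))
    V-iter-ρ : ∀ n x → V (iter (ρ H) n x) ≡ V x
    V-iter-ρ zero x = refl
    V-iter-ρ (suc n) x = trans (V-α _) (trans (V-τ _) (V-iter-ρ n x))

    E-τ : ∀ x → E (τ x) ≡ E x
    E-τ x = sym (cls-complete cE x (τ x) (eτ x ◅ ε))
    E-β : ∀ x → E (β H x) ≡ E x
    E-β x = sym (cls-complete cE x (β H x) (eβ x ◅ ε))
    F-α : ∀ x → F (α H x) ≡ F x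
    F-α x = sym (cls-complete cF x (α H x) (fα x ◅ ε))
    F-β : ∀ x → F (β H x) ≡ F x
    F-β x = sym (cls-complete cF x (β H x) (fβ x ◅ ε))

    Node : Set
    Node = Fin nv ⊎ Fin ne ⊎ Fin nf

    node↔ : Fin (nv + (ne + nf)) ↔ Node
    node↔ = ↔-refl ⊎-Fin↔ (↔-refl ⊎-Fin↔ ↔-refl)

    _≟ₙ_ : DecidableEquality Node
    _≟ₙ_ = Sum.≡-dec Fin._≟_ (Sum.≡-dec Fin._≟_ Fin._≟_)

    vertex edge face : Point → Node
    vertex x = inj₁ (V x)
    edge x = inj₂ (inj₁ (E x))
    face x = inj₂ (inj₂ (F x))

    -- The primal graph has the hypervertices, hyperedges and hyperfaces as nodes; the half-edge
    -- (x , c) lies on the two of them whose boundary walks use colour c.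
    ends : HalfEdge → Node × Node
    ends (x , cτ) = vertex x , edge x
    ends (x , cα) = vertex x , face x
    ends (x , cβ) = edge x , face x

    ends-partner : ∀ h → ends (partner h) ≡ ends h
    ends-partner (x , cτ) = cong₂ (λ v e → inj₁ v , inj₂ (inj₁ e)) (V-τ x) (E-τ x)
    ends-partner (x , cα) = cong₂ (λ v f → inj₁ v , inj₂ (inj₂ f)) (V-α x) (F-α x)
    ends-partner (x , cβ) = cong₂ (λ e f → inj₂ (inj₁ e) , inj₂ (inj₂ f)) (E-β x) (F-β x)

    ends-resp-≈ : ∀ {h h′} → h ≈ h′ → ends h ≡ ends h′
    ends-resp-≈ (refl , inj₁ refl) = refl
    ends-resp-≈ {_ , c} {y , _} (refl , inj₂ refl) = ends-partner (y , c)

    end : HalfEdge → Bool → Node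
    end h false = proj₁ (ends h)
    end h true = proj₂ (ends h)

    end-resp-≈ : ∀ {h h′} → h ≈ h′ → ∀ b → end h b ≡ end h′ b
    end-resp-≈ e false = cong proj₁ (ends-resp-≈ e)
    end-resp-≈ e true = cong proj₂ (ends-resp-≈ e)

    module Connectivity (G : HalfEdge → Set) where

      Link : Node → Node → Set
      Link n n′ = ∃[ h ] G h × (ends h ≡ (n , n′) ⊎ ends h ≡ (n′ , n))

      Connected : Node → Node → Set
      Connected = Star Link

      Connected-sym : ∀ {n n′} → Connected n n′ → Connected n′ n
      Connected-sym = reverse λ (h , g , e) → h , g , swap e

      Effective : HalfEdge → Set
      Effective h = Connected (proj₁ (ends h)) (proj₂ (ends h))

      G⇒effective : ∀ {h} → G h → Effective h
      G⇒effective g = (_ , g , inj₁ refl) ◅ ε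

      effective-resp-≈ : ∀ {h h′} → h ≈ h′ → Effective h → Effective h′
      effective-resp-≈ e = subst (λ (a , b) → Connected a b) (ends-resp-≈ e)

      -- The three half-edges at a point form a triangle on its vertex, edge and face.
      effective-third : ∀ x c → (∀ c′ → c′ ≢ c → Effective (x , c′)) → Effective (x , c)
      effective-third x cτ eff = eff cα (λ ()) ◅◅ Connected-sym (eff cβ (λ ()))
      effective-third x cα eff = eff cτ (λ ()) ◅◅ eff cβ (λ ())
      effective-third x cβ eff = Connected-sym (eff cτ (λ ())) ◅◅ eff cα (λ ())

  4d+2N+2≤6d+4k⇒N<d+2k : ∀ d N k → d * 2 * 2 + (N * 2 + 2) ≤ d * 2 * 3 + (k * 2 + k * 2) → suc N ≤ d + 2 * k
  4d+2N+2≤6d+4k⇒N<d+2k d N k le = +-cancelʳ-≤ (2 * d) (suc N) (d + 2 * k) (*-cancelʳ-≤ _ _ 2 (subst₂ _≤_ (lhs d N) (rhs d k) le))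
    where
    lhs : ∀ d N → d * 2 * 2 + (N * 2 + 2) ≡ (suc N + 2 * d) * 2
    lhs = ℕ-Solver.solve-∀
    rhs : ∀ d k → d * 2 * 3 + (k * 2 + k * 2) ≡ (d + 2 * k + 2 * d) * 2
    rhs = ℕ-Solver.solve-∀

  module Counting (H : RibbonHypermap) {nv ne nf nk : ℕ}
    (cV : ClassCount (VStep H) nv) (cE : ClassCount (EStep H) ne)
    (cF : ClassCount (FStep H) nf) (cK : ClassCount (KStep H) nk) where

    open Gem H
    open Primal H cV cE cF cK
    open ClassCount

    componentRoot : Fin nk → Point
    componentRoot c = proj₁ (cls-surj cK c)

    K-componentRoot : ∀ c → K (componentRoot c) ≡ c
    K-componentRoot c = proj₂ (cls-surj cK c)

    witness : Node → Point
    witness (inj₁ v) = proj₁ (cls-surj cV v)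
    witness (inj₂ (inj₁ e)) = proj₁ (cls-surj cE e)
    witness (inj₂ (inj₂ f)) = proj₁ (cls-surj cF f)

    nodeComponent : Node → Fin nk
    nodeComponent = K ∘ witness

    nodeRoot : Fin nk → Node
    nodeRoot = vertex ∘ componentRoot

    nodeComponent-nodeRoot : ∀ c → nodeComponent (nodeRoot c) ≡ c
    nodeComponent-nodeRoot c = trans (cls-complete cK _ _ (Star.map V⇒K (cls-sound cV _ _ (proj₂ (cls-surj cV _)))))
                                     (K-componentRoot c)
      where
      V⇒K : ∀ {x y} → VStep H x y → KStep H x y
      V⇒K (vτ x) = kτ x
      V⇒K (vα x) = kα x

    module CotreeCount
      (Root : Point → Set) (root? : Decidable Root) (up : Point → Colour) (rank : Point → ℕ)
      (rank-up : ∀ x → ¬ Root x → rank (move (up x) x) < rank x)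
      (roots-separated : ∀ {x y} → Root x → Root y → K x ≡ K y → x ≡ y)
      (g : HalfEdge) (g∉T : ¬ Forest.InTree Root root? up rank rank-up g) where

      open Forest Root root? up rank rank-up

      Cotree : HalfEdge → Set
      Cotree h = ¬ InTree h × ¬ h ≈ g

      Cotree? : Decidable Cotree
      Cotree? h = ¬? (InTree? h) ×-dec ¬? (h ≈? g)

      open Connectivity Cotree

      module _ (all-effective : ∀ h → Effective h) where

        witness-connected : ∀ n → Connected (vertex (witness n)) n
        witness-connected n@(inj₁ v) = subst (Connected (vertex (witness n)) ∘ inj₁) (proj₂ (cls-surj cV v)) ε
        witness-connected n@(inj₂ (inj₁ e)) =
          subst (Connected (vertex (witness n)) ∘ inj₂ ∘ inj₁) (proj₂ (cls-surj cE e)) (all-effective (witness n , cτ))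
        witness-connected n@(inj₂ (inj₂ f)) =
          subst (Connected (vertex (witness n)) ∘ inj₂ ∘ inj₂) (proj₂ (cls-surj cF f)) (all-effective (witness n , cα))

        KStep-connected : ∀ {x y} → KStep H x y → Connected (vertex x) (vertex y)
        KStep-connected (kτ x) = subst (Connected (vertex x) ∘ inj₁) (sym (V-τ x)) ε
        KStep-connected (kα x) = subst (Connected (vertex x) ∘ inj₁) (sym (V-α x)) ε
        KStep-connected (kβ x) =
          all-effective (x , cτ)
          ◅◅ subst (λ e → Connected (inj₂ (inj₁ e)) (vertex (β H x))) (E-β x) (Connected-sym (all-effective (β H x , cτ)))

        node-reaches-root : ∀ n → Connected (nodeRoot (nodeComponent n)) n
        node-reaches-root n = Star.fold (λ x y → Connected (vertex x) (vertex y)) (λ s c → KStep-connected s ◅◅ c) ε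
                                (cls-sound cK _ _ (K-componentRoot _))
                              ◅◅ witness-connected n

        NodeRoot : Node → Set
        NodeRoot n = n ≡ nodeRoot (nodeComponent n)

        NodeRoot? : Decidable NodeRoot
        NodeRoot? n = n ≟ₙ nodeRoot (nodeComponent n)

        Adjacent : Node → HalfEdge × Bool → Set
        Adjacent n (h , b) = Cotree h × end h b ≡ n

        across : Node → HalfEdge × Bool → Node
        across _ (h , b) = end h (not b)

        module NodeForest = SpanningForest
          (↔Fin⇒exhaustible (halfEdge↔ ×-Fin↔ Fin.2↔Bool))
          NodeRoot NodeRoot? Adjacent (λ n (h , b) → Cotree? h ×-dec (end h b ≟ₙ n))
          across (length ∘ node-reaches-root) (g , true)
        open NodeForest using (Reach; dist) renaming (parent to nodeParent)

        link-reach : ∀ {m n n′} → Link n n′ → Reach m n → Reach (suc m) n′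
        link-reach (h , ch , inj₁ refl) r = inj₂ ((h , true) , (ch , refl) , r)
        link-reach (h , ch , inj₂ refl) r = inj₂ ((h , false) , (ch , refl) , r)

        connected-reach : ∀ {m n n′} (c : Connected n n′) → Reach m n → Reach (length c + m) n′
        connected-reach ε r = r
        connected-reach {m} {n′ = n′} (l ◅ c) r =
          subst (λ k → Reach k n′) (+-suc (length c) m) (connected-reach c (link-reach {m} l r))

        nodeParent-step : ∀ n → ¬ NodeRoot n → Adjacent n (nodeParent n) × dist (across n (nodeParent n)) < dist n
        nodeParent-step n = NodeForest.parent-step n
          (subst (λ k → Reach k n) (+-identityʳ (length (node-reaches-root n))) (connected-reach {0} (node-reaches-root n) root))
          where
          root : Reach 0 (nodeRoot (nodeComponent n))
          root = cong nodeRoot (sym (nodeComponent-nodeRoot (nodeComponent n)))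

        parent-edge-injective : ∀ {n n′ h h′ b b′} → Adjacent n (h , b) → Adjacent n′ (h′ , b′) →
                                dist (end h (not b)) < dist n → dist (end h′ (not b′)) < dist n′ → h ≈ h′ → n ≡ n′
        parent-edge-injective {n} {n′} {h} {h′} {b} {b′} (_ , hb≡n) (_ , h′b′≡n′) up< up′< h≈h′ = by-cases (b Bool.≟ b′)
          where
          by-cases : Dec (b ≡ b′) → n ≡ n′
          by-cases (yes refl) = trans (sym hb≡n) (trans (end-resp-≈ h≈h′ b) h′b′≡n′)
          by-cases (no b≢b′) = contradiction (<-trans n′<n n<n′) (<-irrefl refl)
            where
            n′<n : dist n′ < dist n
            n′<n = subst (λ m → dist m < dist n)
                     (trans (cong (end h) (sym (¬-not (b≢b′ ∘ sym)))) (trans (end-resp-≈ h≈h′ b′) h′b′≡n′)) up<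
            n<n′ : dist n < dist n′
            n<n′ = subst (λ m → dist m < dist n′)
                     (trans (cong (end h′) (sym (¬-not b≢b′))) (trans (sym (end-resp-≈ h≈h′ b)) hb≡n)) up′<

        nodeParent-injective : ∀ {n n′} → ¬ NodeRoot n → ¬ NodeRoot n′ → proj₁ (nodeParent n) ≈ proj₁ (nodeParent n′) → n ≡ n′
        nodeParent-injective {n} {n′} ¬r ¬r′ =
          let adj , up< = nodeParent-step n ¬r ; adj′ , up′< = nodeParent-step n′ ¬r′
          in parent-edge-injective {h = proj₁ (nodeParent n)} {proj₁ (nodeParent n′)} {proj₂ (nodeParent n)} {proj₂ (nodeParent n′)}
                                   adj adj′ up< up′<

        side : HalfEdge → Bool → HalfEdge
        side h true = h
        side h false = partner h

        side-≈ : ∀ h b → side h b ≈ h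
        side-≈ h true = ≈-refl
        side-≈ h false = partner-≈ h

        side-injective : ∀ h {b b′} → side h b ≡ side h b′ → b ≡ b′
        side-injective h {true} {true} _ = refl
        side-injective h {false} {false} _ = refl
        side-injective h {true} {false} eq = contradiction (sym eq) (partner-≢ h)
        side-injective h {false} {true} eq = contradiction eq (partner-≢ h)

        side-≡⇒≈ : ∀ {h h′ b b′} → side h b ≡ side h′ b′ → h ≈ h′
        side-≡⇒≈ {h} {h′} {b} {b′} eq = ≈-trans (≈-sym (side-≈ h b)) (subst (_≈ h′) (sym eq) (side-≈ h′ b′))

        -- Each point other than a root names the two sides of its tree edge, each node other
        -- than a root the two sides of its parent edge in the cotree forest; roots are named by
        -- their component.  Together with the two sides of g this is injective.
        Source : Set
        Source = (Point × Bool) ⊎ (Node × Bool) ⊎ Bool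

        Target : Set
        Target = HalfEdge ⊎ (Fin nk × Bool) ⊎ (Fin nk × Bool)

        encodePoint : ∀ x → Dec (Root x) → Bool → Target
        encodePoint x (yes _) b = inj₂ (inj₁ (K x , b))
        encodePoint x (no _) b = inj₁ (side (x , up x) b)

        encodeNode : ∀ n → Dec (NodeRoot n) → Bool → Target
        encodeNode n (yes _) b = inj₂ (inj₂ (nodeComponent n , b))
        encodeNode n (no _) b = inj₁ (side (proj₁ (nodeParent n)) b)

        encode : Source → Target
        encode (inj₁ (x , b)) = encodePoint x (root? x) b
        encode (inj₂ (inj₁ (n , b))) = encodeNode n (NodeRoot? n) b
        encode (inj₂ (inj₂ b)) = inj₁ (side g b)

        encodePoint-injective : ∀ {x y b b′} dx dy → encodePoint x dx b ≡ encodePoint y dy b′ → (x , b) ≡ (y , b′)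
        encodePoint-injective (yes rx) (yes ry) eq =
          let eq′ = inj₁-injective (inj₂-injective eq)
          in cong₂ _,_ (roots-separated rx ry (,-injectiveˡ eq′)) (,-injectiveʳ eq′)
        encodePoint-injective (yes _) (no _) ()
        encodePoint-injective (no _) (yes _) ()
        encodePoint-injective {x} (no ¬rx) (no ¬ry) eq with tree-edge-injective ¬rx ¬ry (side-≡⇒≈ (inj₁-injective eq))
        ... | refl = cong (x ,_) (side-injective (x , up x) (inj₁-injective eq))

        encodeNode-injective : ∀ {n n′ b b′} dn dn′ → encodeNode n dn b ≡ encodeNode n′ dn′ b′ → (n , b) ≡ (n′ , b′)
        encodeNode-injective (yes rn) (yes rn′) eq =
          let eq′ = inj₂-injective (inj₂-injective eq)
          in cong₂ _,_ (trans rn (trans (cong nodeRoot (,-injectiveˡ eq′)) (sym rn′))) (,-injectiveʳ eq′)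
        encodeNode-injective (yes _) (no _) ()
        encodeNode-injective (no _) (yes _) ()
        encodeNode-injective {n} (no ¬rn) (no ¬rn′) eq with nodeParent-injective ¬rn ¬rn′ (side-≡⇒≈ (inj₁-injective eq))
        ... | refl = cong (n ,_) (side-injective (proj₁ (nodeParent n)) (inj₁-injective eq))

        point≢node : ∀ {x n b b′} dx dn → encodePoint x dx b ≢ encodeNode n dn b′
        point≢node (yes _) (yes _) ()
        point≢node (yes _) (no _) ()
        point≢node (no _) (yes _) ()
        point≢node {x} {n} (no ¬rx) (no ¬rn) eq =
          proj₁ (proj₁ (proj₁ (nodeParent-step n ¬rn))) (x , ¬rx , ≈-sym (side-≡⇒≈ (inj₁-injective eq)))

        point≢g : ∀ {x b b′} dx → encodePoint x dx b ≢ inj₁ (side g b′)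
        point≢g (yes _) ()
        point≢g {x} (no ¬rx) eq = g∉T (x , ¬rx , ≈-sym (side-≡⇒≈ (inj₁-injective eq)))

        node≢g : ∀ {n b b′} dn → encodeNode n dn b ≢ inj₁ (side g b′)
        node≢g (yes _) ()
        node≢g {n} (no ¬rn) eq = proj₂ (proj₁ (proj₁ (nodeParent-step n ¬rn))) (side-≡⇒≈ (inj₁-injective eq))

        encode-injective : ∀ {s s′} → encode s ≡ encode s′ → s ≡ s′
        encode-injective {inj₁ _} {inj₁ _} eq = cong inj₁ (encodePoint-injective _ _ eq)
        encode-injective {inj₁ _} {inj₂ (inj₁ _)} eq = contradiction eq (point≢node _ _)
        encode-injective {inj₁ _} {inj₂ (inj₂ _)} eq = contradiction eq (point≢g _)
        encode-injective {inj₂ (inj₁ _)} {inj₁ _} eq = contradiction (sym eq) (point≢node _ _)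
        encode-injective {inj₂ (inj₁ _)} {inj₂ (inj₁ _)} eq = cong (inj₂ ∘ inj₁) (encodeNode-injective _ _ eq)
        encode-injective {inj₂ (inj₁ _)} {inj₂ (inj₂ _)} eq = contradiction eq (node≢g _)
        encode-injective {inj₂ (inj₂ _)} {inj₁ _} eq = contradiction (sym eq) (point≢g _)
        encode-injective {inj₂ (inj₂ _)} {inj₂ (inj₁ _)} eq = contradiction (sym eq) (node≢g _)
        encode-injective {inj₂ (inj₂ b)} {inj₂ (inj₂ b′)} eq = cong (inj₂ ∘ inj₂) (side-injective g (inj₁-injective eq))

        v+e+f<d+2k : suc (nv + (ne + nf)) ≤ d H + 2 * nk
        v+e+f<d+2k = 4d+2N+2≤6d+4k⇒N<d+2k (d H) (nv + (ne + nf)) nk (injective⇒size-≤ source↔ target↔ encode encode-injective)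
          where
          source↔ : Fin (d H * 2 * 2 + ((nv + (ne + nf)) * 2 + 2)) ↔ Source
          source↔ = (point↔ ×-Fin↔ Fin.2↔Bool) ⊎-Fin↔ ((node↔ ×-Fin↔ Fin.2↔Bool) ⊎-Fin↔ Fin.2↔Bool)
          target↔ : Fin (d H * 2 * 3 + (nk * 2 + nk * 2)) ↔ Target
          target↔ = halfEdge↔ ⊎-Fin↔ ((↔-refl ×-Fin↔ Fin.2↔Bool) ⊎-Fin↔ (↔-refl ×-Fin↔ Fin.2↔Bool))

  module Alternation (H : RibbonHypermap) {nv ne nf nk : ℕ}
    (cV : ClassCount (VStep H) nv) (cE : ClassCount (EStep H) ne)
    (cF : ClassCount (FStep H) nf) (cK : ClassCount (KStep H) nk)
    (p : Pt (d H)) {i j k : ℕ} (0<i : 0 < i) (i<j : i < j) (j<k : j < k)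
    (orbit : ∀ t → 1 ≤ t → t ≤ k → iter (ρ H) t p ≢ p)
    (pathA : Star (AvoidStep H p) p (iter (ρ H) j p))
    (pathB : Star (AvoidStep H p) (iter (ρ H) i p) (iter (ρ H) k p))
    (A∌ri : ¬ Star (AvoidStep H p) p (iter (ρ H) i p)) where

    open Gem H
    open Primal H cV cE cF cK
    open Counting H cV cE cF cK

    -- r walks around the hypervertex v of p; cl₁, …, cl₄ are the segments at r 0, r i, r j, r k.
    r : ℕ → Point
    r t = iter (ρ H) t p

    r-+ : ∀ s t → r (s + t) ≡ iter (ρ H) s (r t)
    r-+ s t = iter-+ s t p

    r-≢ : ∀ {s t} → s < t → t ≤ k → r s ≢ r t
    r-≢ {s} {t} s<t t≤k rs≡rt = orbit (t ∸ s) (m<n⇒0<n∸m s<t) (≤-trans (m∸n≤m t s) t≤k)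
      (sym (iter-ρ-injective s (trans rs≡rt (trans (cong r (sym (m+[n∸m]≡n (<⇒≤ s<t)))) (r-+ s (t ∸ s))))))

    r-injective : ∀ {s t} → s ≤ k → t ≤ k → r s ≡ r t → s ≡ t
    r-injective {s} {t} s≤k t≤k eq with <-cmp s t
    ... | tri< s<t _ _ = contradiction eq (r-≢ s<t t≤k)
    ... | tri≈ _ s≡t _ = s≡t
    ... | tri> _ _ t<s = contradiction (sym eq) (r-≢ t<s s≤k)

    r≢τr : ∀ s t → r s ≢ τ (r t)
    r≢τr s t eq with <-cmp s t
    ... | tri< s<t _ _ = iter-ρ≢τ (t ∸ s) (r s) (begin
        iter (ρ H) (t ∸ s) (r s)   ≡⟨ r-+ (t ∸ s) s ⟨
        r (t ∸ s + s)              ≡⟨ cong r (m∸n+n≡m (<⇒≤ s<t)) ⟩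
        r t                        ≡⟨ τ-involutive (r t) ⟨
        τ (τ (r t))                ≡⟨ cong τ eq ⟨
        τ (r s)                    ∎)
      where open ≡-Reasoning
    ... | tri≈ _ refl _ = τ-fixedPointFree (r s) (sym eq)
    ... | tri> _ _ t<s = iter-ρ≢τ (s ∸ t) (r t) (trans (sym (r-+ (s ∸ t) t)) (trans (cong r (m∸n+n≡m (<⇒≤ t<s))) eq))

    Avoid : Point → Point → Set
    Avoid = Star (AvoidStep H p)

    AvoidStep-sym : ∀ {x y} → AvoidStep H p x y → AvoidStep H p y x
    AvoidStep-sym (aτ x) = subst (AvoidStep H p (τ x)) (τ-involutive x) (aτ (τ x))
    AvoidStep-sym (aβ x) = subst (AvoidStep H p (β H x)) (β-inv H x) (aβ (β H x))
    AvoidStep-sym (aα x x≁p) = subst (AvoidStep H p (α H x)) (α-inv H x) (aα (α H x) (x≁p ∘ (vα x ◅_)))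

    InA InB : Point → Set
    InA = Avoid p
    InB = Avoid (r i)

    A∩B-empty : ∀ {x} → InA x → InB x → ⊥
    A∩B-empty a b = A∌ri (a ◅◅ reverse AvoidStep-sym b)

    qm q₀ : Point
    qm = r j
    q₀ = τ qm

    g : HalfEdge
    g = qm , cτ

    arc : ∀ {s t} → s ≤′ t → Walk (r s) (r t)
    arc ≤′-refl = ε
    arc (≤′-step s≤′t) = arc s≤′t ◅◅ (step cτ refl ◅ step cα refl ◅ ε)

    ∈ʷ-arc : ∀ {s t h} (s≤′t : s ≤′ t) → h ∈ʷ arc s≤′t → proj₂ h ≡ cα ⊎ ∃[ u ] s ≤ u × u < t × h ≈ (r u , cτ)
    ∈ʷ-arc ≤′-refl ()
    ∈ʷ-arc {s} (≤′-step {t} s≤′t) h∈ with ∈ʷ-◅◅ (arc s≤′t) _ h∈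
    ... | inj₁ h∈′ with ∈ʷ-arc s≤′t h∈′
    ...   | inj₁ isα = inj₁ isα
    ...   | inj₂ (u , s≤u , u<t , h≈) = inj₂ (u , s≤u , ≤-trans u<t (n≤1+n t) , h≈)
    ∈ʷ-arc {s} (≤′-step {t} s≤′t) h∈ | inj₂ (inj₁ h≈) = inj₂ (t , ≤′⇒≤ s≤′t , ≤-refl , h≈)
    ∈ʷ-arc (≤′-step s≤′t) h∈ | inj₂ (inj₂ (inj₁ (isα , _))) = inj₁ isα

    avoid⇒step : ∀ {x y} → AvoidStep H p x y → Step x y
    avoid⇒step (aτ x) = step cτ refl
    avoid⇒step (aβ x) = step cβ refl
    avoid⇒step (aα x _) = step cα refl

    ∈ʷ-avoid : ∀ {x y h} (w : Avoid x y) → h ∈ʷ Star.map avoid⇒step w → Avoid x (proj₁ h)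
    ∈ʷ-avoid (aτ x ◅ w) (inj₁ (_ , inj₁ refl)) = ε
    ∈ʷ-avoid (aτ x ◅ w) (inj₁ (refl , inj₂ refl)) = aτ x ◅ ε
    ∈ʷ-avoid (aβ x ◅ w) (inj₁ (_ , inj₁ refl)) = ε
    ∈ʷ-avoid (aβ x ◅ w) (inj₁ (refl , inj₂ refl)) = aβ x ◅ ε
    ∈ʷ-avoid (aα x x≁p ◅ w) (inj₁ (_ , inj₁ refl)) = ε
    ∈ʷ-avoid (aα x x≁p ◅ w) (inj₁ (refl , inj₂ refl)) = aα x x≁p ◅ ε
    ∈ʷ-avoid (st ◅ w) (inj₂ h∈) = st ◅ ∈ʷ-avoid w h∈

    -- From q₀ around v to r k, back to r i inside B, and around v to r j = qm.
    W : Walk q₀ qm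
    W = step cα refl ◅ arc (≤⇒≤′ j<k) ◅◅ reverse step-sym (Star.map avoid⇒step pathB) ◅◅ arc (≤⇒≤′ (<⇒≤ i<j))

    OnArc : HalfEdge → Set
    OnArc h = ∃[ u ] i ≤ u × u ≤ k × u ≢ j × h ≈ (r u , cτ)

    ∈ʷ-W : ∀ {h} → h ∈ʷ W → proj₂ h ≡ cα ⊎ OnArc h ⊎ InB (proj₁ h)
    ∈ʷ-W (inj₁ (isα , _)) = inj₁ isα
    ∈ʷ-W (inj₂ h∈) with ∈ʷ-◅◅ (arc (≤⇒≤′ j<k)) _ h∈
    ... | inj₁ h∈′ with ∈ʷ-arc (≤⇒≤′ j<k) h∈′
    ...   | inj₁ isα = inj₁ isα
    ...   | inj₂ (u , j<u , u<k , h≈) =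
      inj₂ (inj₁ (u , <⇒≤ (<-trans i<j j<u) , <⇒≤ u<k , (λ { refl → <-irrefl refl j<u }) , h≈))
    ∈ʷ-W (inj₂ h∈) | inj₂ h∈′ with ∈ʷ-◅◅ (reverse step-sym (Star.map avoid⇒step pathB)) _ h∈′
    ... | inj₁ h∈B = inj₂ (inj₂ (∈ʷ-avoid pathB (∈ʷ-reverse (Star.map avoid⇒step pathB) h∈B)))
    ... | inj₂ h∈″ with ∈ʷ-arc (≤⇒≤′ (<⇒≤ i<j)) h∈″
    ...   | inj₁ isα = inj₁ isα
    ...   | inj₂ (u , i≤u , u<j , h≈) =
      inj₂ (inj₁ (u , i≤u , <⇒≤ (<-trans u<j j<k) , (λ { refl → <-irrefl refl u<j }) , h≈))

    g∉W : ¬ g ∈ʷ W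
    g∉W g∈ with ∈ʷ-W g∈
    ... | inj₁ ()
    ... | inj₂ (inj₁ (u , _ , u≤k , u≢j , _ , inj₁ rj≡ru)) = u≢j (sym (r-injective (<⇒≤ j<k) u≤k rj≡ru))
    ... | inj₂ (inj₁ (u , _ , _ , _ , _ , inj₂ rj≡τru)) = r≢τr j u rj≡τru
    ... | inj₂ (inj₂ B-qm) = A∩B-empty pathA B-qm

    pτ∉W : ¬ (p , cτ) ∈ʷ W
    pτ∉W pτ∈ with ∈ʷ-W pτ∈
    ... | inj₁ ()
    ... | inj₂ (inj₁ (u , i≤u , u≤k , _ , _ , inj₁ p≡ru)) = r-≢ (<-≤-trans 0<i i≤u) u≤k p≡ru
    ... | inj₂ (inj₁ (u , _ , _ , _ , _ , inj₂ p≡τru)) = r≢τr 0 u p≡τru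
    ... | inj₂ (inj₂ B-p) = A∩B-empty ε B-p

    Aβ∉W : ∀ {x} → InA x → ¬ (x , cβ) ∈ʷ W
    Aβ∉W ax xβ∈ with ∈ʷ-W xβ∈
    ... | inj₁ ()
    ... | inj₂ (inj₁ (_ , _ , _ , _ , () , _))
    ... | inj₂ (inj₂ B-x) = A∩B-empty ax B-x

    OnW : Point → Set
    OnW x = ∃[ c ] (x , c) ∈ʷ W

    OnW? : Decidable OnW
    OnW? x = ↔Fin⇒exhaustible colour↔ (λ c → (x , c) ∈ʷ? W)

    rootOf : Fin nk → Point
    rootOf c with c Fin.≟ K qm
    ... | yes _ = qm
    ... | no _ = componentRoot c

    Root : Point → Set
    Root x = x ≡ qm ⊎ (K x ≢ K qm × x ≡ componentRoot (K x))

    root? : Decidable Root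
    root? x = (x ≟ₚ qm) ⊎-dec (¬? (K x Fin.≟ K qm) ×-dec (x ≟ₚ componentRoot (K x)))

    Root-rootOf : ∀ c → Root (rootOf c)
    Root-rootOf c with c Fin.≟ K qm
    ... | yes _ = inj₁ refl
    ... | no c≢ = inj₂ ((λ eq → c≢ (trans (sym (K-componentRoot c)) eq)) , cong componentRoot (sym (K-componentRoot c)))

    K-rootOf : ∀ c → K (rootOf c) ≡ c
    K-rootOf c with c Fin.≟ K qm
    ... | yes c≡ = sym c≡
    ... | no _ = K-componentRoot c

    roots-separated : ∀ {x y} → Root x → Root y → K x ≡ K y → x ≡ y
    roots-separated (inj₁ refl) (inj₁ refl) _ = refl
    roots-separated (inj₁ refl) (inj₂ (y≁ , _)) eq = contradiction (sym eq) y≁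
    roots-separated (inj₂ (x≁ , _)) (inj₁ refl) eq = contradiction eq x≁
    roots-separated (inj₂ (_ , x≡)) (inj₂ (_ , y≡)) eq = trans x≡ (trans (cong componentRoot eq) (sym y≡))

    -- On W the forest may only use edges of W, so that the tree path from q₀ to the root qm
    -- stays inside W and g is left out of the tree.
    Adjacent : Point → Colour → Set
    Adjacent x c = (x , c) ∈ʷ W ⊎ ¬ OnW x

    pathToRoot : ∀ x → Star (KStep H) (rootOf (K x)) x
    pathToRoot x = ClassCount.cls-sound cK _ x (K-rootOf (K x))

    module PointForest = SpanningForest (↔Fin⇒exhaustible colour↔) Root root?
      Adjacent (λ x c → ((x , c) ∈ʷ? W) ⊎-dec ¬? (OnW? x)) (λ x c → move c x)
      (λ x → length W + length (pathToRoot x)) cτ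
    open PointForest using (Reach; reach-mono; dist)

    walk-reach : ∀ {x} (w : Walk x qm) → (∀ {h} → h ∈ʷ w → h ∈ʷ W) → Reach (length w) x
    walk-reach ε _ = inj₁ refl
    walk-reach (step c refl ◅ w) w⊆W = inj₂ (c , inj₁ (w⊆W (inj₁ ≈-refl)) , walk-reach w (w⊆W ∘ inj₂))

    walk-reach-∈ : ∀ {x y c} (w : Walk y qm) → (∀ {h} → h ∈ʷ w → h ∈ʷ W) → (x , c) ∈ʷ w → Reach (length w) x
    walk-reach-∈ w@(_ ◅ _) w⊆W (inj₁ (_ , inj₁ refl)) = walk-reach w w⊆W
    walk-reach-∈ (step _ refl ◅ w) w⊆W (inj₁ (refl , inj₂ refl)) = inj₁ (walk-reach w (w⊆W ∘ inj₂))
    walk-reach-∈ (_ ◅ w) w⊆W (inj₂ x∈) = inj₁ (walk-reach-∈ w (w⊆W ∘ inj₂) x∈)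

    OnW-reach : ∀ {x} → OnW x → Reach (length W) x
    OnW-reach (_ , x∈) = walk-reach-∈ W (λ h∈ → h∈) x∈

    KStep-back : ∀ {x y} → KStep H x y → ∃[ c ] move c y ≡ x
    KStep-back (kτ x) = cτ , τ-involutive x
    KStep-back (kα x) = cα , α-inv H x
    KStep-back (kβ x) = cβ , β-inv H x

    KStep-reach : ∀ {n x y} → KStep H x y → Reach (length W + n) x → Reach (length W + suc n) y
    KStep-reach {n} {y = y} st rx with OnW? y
    ... | yes onW = reach-mono (m≤m+n (length W) (suc n)) (OnW-reach onW)
    ... | no ¬onW = let c , back = KStep-back st in
      subst (λ m → Reach m y) (sym (+-suc (length W) n)) (inj₂ (c , inj₂ ¬onW , subst (Reach (length W + n)) (sym back) rx))

    KPath-reach : ∀ {n x y} (s : Star (KStep H) x y) → Reach (length W + n) x → Reach (length W + (length s + n)) y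
    KPath-reach ε rx = rx
    KPath-reach {n} {y = y} (st ◅ s) rx =
      subst (λ m → Reach (length W + m) y) (+-suc (length s) n) (KPath-reach s (KStep-reach st rx))

    point-reach : ∀ x → Reach (length W + length (pathToRoot x)) x
    point-reach x = subst (λ m → Reach (length W + m) x) (+-identityʳ (length (pathToRoot x)))
      (KPath-reach (pathToRoot x) (reach-mono {0} {length W + 0} z≤n (Root-rootOf (K x))))

    up : Point → Colour
    up = PointForest.parent

    up-adjacent : ∀ x → ¬ Root x → Adjacent x (up x)
    up-adjacent x = proj₁ ∘ PointForest.parent-step x (point-reach x)

    rank-up : ∀ x → ¬ Root x → dist (move (up x) x) < dist x
    rank-up x = proj₂ ∘ PointForest.parent-step x (point-reach x)

    open Forest Root root? up dist rank-up

    OnW-q₀ : OnW q₀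
    OnW-q₀ = cα , inj₁ ≈-refl

    g∉T : ¬ InTree g
    g∉T (y , ¬ry , _ , inj₁ refl) = ¬ry (inj₁ refl)
    g∉T (y , ¬ry , g≈@(_ , inj₂ qm≡τy)) =
      [ (λ y∈W → g∉W (∈ʷ-resp-≈ W g≈ y∈W))
      , (λ ¬onW → ¬onW (subst OnW (trans (cong τ qm≡τy) (τ-involutive y)) OnW-q₀))
      ] (up-adjacent y ¬ry)

    Cotree : HalfEdge → Set
    Cotree = CotreeCount.Cotree Root root? up dist rank-up roots-separated g g∉T

    open Connectivity Cotree

    module PeelEffective = Peel Effective effective-resp-≈ effective-third

    OffW : Point → Set
    OffW x = ¬ OnW x × x ≢ qm

    OffW-up : ∀ x → ¬ Root x → OffW (parent x) → OffW x
    OffW-up x ¬rx (¬onW-parent , _) = ¬onW , ¬rx ∘ inj₁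
      where
      ¬onW : ¬ OnW x
      ¬onW onW = [ (λ x∈W → ¬onW-parent (up x , ∈ʷ-resp-≈ W (partner-≈ (x , up x)) x∈W)) , (λ ¬onW′ → ¬onW′ onW) ]
                   (up-adjacent x ¬rx)

    OffW-≉g : ∀ {x} c → OffW x → ¬ (x , c) ≈ g
    OffW-≉g c (_ , x≢qm) (_ , inj₁ x≡qm) = x≢qm x≡qm
    OffW-≉g c (¬onW , _) (refl , inj₂ x≡q₀) = ¬onW (subst OnW (sym x≡q₀) OnW-q₀)

    effective-off-W : ∀ h → ¬ h ≈ g → ¬ h ∈ʷ W → Effective h
    effective-off-W h h≉g h∉W = by-cases (InTree? h)
      where
      by-cases : Dec (InTree h) → Effective h
      by-cases (no h∉T) = G⇒effective (h∉T , h≉g)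
      by-cases (yes (y , ¬ry , h≈)) = effective-resp-≈ (≈-sym h≈)
        (PeelEffective.tree-eff OffW OffW-up (λ x c offW x∉T → G⇒effective (x∉T , OffW-≉g c offW))
                                y (¬onW , ¬ry ∘ inj₁) ¬ry)
        where
        ¬onW : ¬ OnW y
        ¬onW onW = [ (λ y∈W → h∉W (∈ʷ-resp-≈ W h≈ y∈W)) , (λ ¬onW′ → ¬onW′ onW) ] (up-adjacent y ¬ry)

    Aβ-effective : ∀ {x} → InA x → Effective (x , cβ)
    Aβ-effective ax = effective-off-W _ (λ { (() , _) }) (Aβ∉W ax)

    A-chain : ∀ {x y} → InA x → Avoid x y → Connected (edge x) (edge y)
    A-chain ax ε = ε
    A-chain {y = y} ax (aτ x ◅ s) = subst (λ e → Connected (inj₂ (inj₁ e)) (edge y)) (E-τ x) (A-chain (ax ◅◅ aτ x ◅ ε) s)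
    A-chain {y = y} ax (aβ x ◅ s) = subst (λ e → Connected (inj₂ (inj₁ e)) (edge y)) (E-β x) (A-chain (ax ◅◅ aβ x ◅ ε) s)
    A-chain ax (aα x x≁p ◅ s) =
      Aβ-effective ax
      ◅◅ subst (λ f → Connected (inj₂ (inj₂ f)) (edge (α H x))) (F-α x) (Connected-sym (Aβ-effective aαx))
      ◅◅ A-chain aαx s
      where
      aαx : InA (α H x)
      aαx = ax ◅◅ aα x x≁p ◅ ε

    -- The τ-edge at p joins v to the hyperedge of p, and the path A leads on to the hyperedge of qm.
    g-effective : Effective g
    g-effective = subst (λ v → Connected (inj₁ v) (edge qm)) (sym (V-iter-ρ j p))
      (effective-off-W (p , cτ) pτ≉g pτ∉W ◅◅ A-chain ε pathA)
      where
      pτ≉g : ¬ (p , cτ) ≈ g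
      pτ≉g (_ , inj₁ p≡qm) = r-≢ (<-trans 0<i i<j) (<⇒≤ j<k) p≡qm
      pτ≉g (_ , inj₂ p≡q₀) = r≢τr 0 j p≡q₀

    cotree-effective : ∀ h → ¬ InTree h → Effective h
    cotree-effective h h∉T = by-cases (h ≈? g)
      where
      by-cases : Dec (h ≈ g) → Effective h
      by-cases (yes h≈g) = effective-resp-≈ (≈-sym h≈g) g-effective
      by-cases (no h≉g) = G⇒effective (h∉T , h≉g)

    all-effective : ∀ h → Effective h
    all-effective h = by-cases (InTree? h)
      where
      by-cases : Dec (InTree h) → Effective h
      by-cases (no h∉T) = cotree-effective h h∉T
      by-cases (yes (y , ¬ry , h≈)) = effective-resp-≈ (≈-sym h≈)
        (PeelEffective.tree-eff (λ _ → ⊤) (λ _ _ _ → tt) (λ x c _ → cotree-effective (x , c)) y tt ¬ry)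

    v+e+f<d+2k : suc (nv + (ne + nf)) ≤ d H + 2 * nk
    v+e+f<d+2k = CotreeCount.v+e+f<d+2k Root root? up dist rank-up roots-separated g g∉T all-effective

module Genus where

  open import Data.Nat using (ℕ; suc; _≤_)
  import Data.Nat as ℕ
  import Data.Nat.Properties as ℕ
  open import Data.Integer using (ℤ; +_; _+_; _-_; _⊖_; _<_)
  open import Data.Integer.Properties using (pos-+; m-n≡m⊖n; n⊖n≡0; ⊖-monoˡ-<)
  open import Relation.Binary.PropositionalEquality using (_≡_; sym; trans; cong; cong₂; subst₂; module ≡-Reasoning)
  import Data.Nat.Tactic.RingSolver as ℕ-Solver
  import Data.Integer.Tactic.RingSolver as ℤ-Solver

  eulerGenus-positive : ∀ H v e f k → suc (v ℕ.+ (e ℕ.+ f)) ≤ d H ℕ.+ 2 ℕ.* k → + 0 < eulerGenus H v e f k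
  eulerGenus-positive H v e f k v+e+f<d+2k = subst₂ _<_ (n⊖n≡0 R) (sym as-⊖) (⊖-monoˡ-< R R<L)
    where
    a b : ℕ
    a = isoV H
    b = isoE H

    L R : ℕ
    L = 2 ℕ.* (k ℕ.+ a ℕ.+ b) ℕ.+ d H
    R = (v ℕ.+ a) ℕ.+ (e ℕ.+ b) ℕ.+ (f ℕ.+ a ℕ.+ b)

    R<L : R ℕ.< L
    R<L = subst₂ ℕ._<_ (R≡ v e f a b) (L≡ (d H) k a b) (ℕ.+-monoˡ-< (2 ℕ.* (a ℕ.+ b)) v+e+f<d+2k)
      where
      R≡ : ∀ v e f a b → v ℕ.+ (e ℕ.+ f) ℕ.+ 2 ℕ.* (a ℕ.+ b) ≡ (v ℕ.+ a) ℕ.+ (e ℕ.+ b) ℕ.+ (f ℕ.+ a ℕ.+ b)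
      R≡ = ℕ-Solver.solve-∀
      L≡ : ∀ d k a b → d ℕ.+ 2 ℕ.* k ℕ.+ 2 ℕ.* (a ℕ.+ b) ≡ 2 ℕ.* (k ℕ.+ a ℕ.+ b) ℕ.+ d
      L≡ = ℕ-Solver.solve-∀

    regroup : ∀ (x y₁ y₂ y₃ : ℤ) → x - y₁ - y₂ - y₃ ≡ x - (y₁ + y₂ + y₃)
    regroup = ℤ-Solver.solve-∀

    as-⊖ : eulerGenus H v e f k ≡ L ⊖ R
    as-⊖ = begin
      eulerGenus H v e f k
        ≡⟨ regroup (+ (2 ℕ.* (k ℕ.+ a ℕ.+ b)) + + d H) (+ (v ℕ.+ a)) (+ (e ℕ.+ b)) (+ (f ℕ.+ a ℕ.+ b)) ⟩
      (+ (2 ℕ.* (k ℕ.+ a ℕ.+ b)) + + d H) - (+ (v ℕ.+ a) + + (e ℕ.+ b) + + (f ℕ.+ a ℕ.+ b))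
        ≡⟨ cong₂ _-_ (pos-+ (2 ℕ.* (k ℕ.+ a ℕ.+ b)) (d H))
                     (trans (cong (_+ + (f ℕ.+ a ℕ.+ b)) (pos-+ (v ℕ.+ a) (e ℕ.+ b)))
                            (pos-+ (v ℕ.+ a ℕ.+ (e ℕ.+ b)) (f ℕ.+ a ℕ.+ b))) ⟨
      + L - + R
        ≡⟨ m-n≡m⊖n L R ⟩
      L ⊖ R ∎
      where open ≡-Reasoning

open Hypermap using (module Alternation)
open Genus using (eulerGenus-positive)
open import Data.Nat using (ℕ)
open import Data.Integer using (_<_; +_)
open import Data.Product using (_,_)

lemma4p5 : (H : RibbonHypermap) (nv ne nf nk : ℕ)
    → ClassCount (VStep H) nv
    → ClassCount (EStep H) ne
    → ClassCount (FStep H) nf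
    → ClassCount (KStep H) nk
    → HasAlternating H
    → + 0 < eulerGenus H nv ne nf nk
lemma4p5 H nv ne nf nk cV cE cF cK (p , i , j , k , 0<i , i<j , j<k , orbit , pathA , pathB , A∌ri) =
  eulerGenus-positive H nv ne nf nk (Alternation.v+e+f<d+2k H cV cE cF cK p 0<i i<j j<k orbit pathA pathB A∌ri)
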